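{- Let $G$ be a graph containing no triangle and no induced $T_{123}$, and let $P=p_1\!-\!p_2\!-\!\cdots\!-\!p_k$ be an inclusion-wise maximal induced path of $G$. If $k\geq 8$, then every vertex $v$ of $G\setminus P$ satisfies one of: (0) $N(v)\cap V(P)=\emptyset$; (1) $N(v)\cap V(P)=\{p_2\}$ or $N(v)\cap V(P)=\{p_{k-1}\}$; (2) $N(v)\cap V(P)=\{p_i,p_{i+2}\}$ for some $1\le i\le k-2$; (o) $N(v)\cap V(P)=\{p_1,p_3,\dots,p_{2\lceil k/2\rceil-1}\}$; (e) $N(v)\cap V(P)=\{p_2,p_4,\dots,p_{2\lfloor k/2\rfloor}\}$; (c) $N(v)\cap V(P)=\{p_1,p_k\}$.
   Context: $T_{123}$ is the tree on vertices $a,b,c,d,e,f,g$ with edges $ab,ac,cd,ae,ef,fg$. "Contains" means as an induced subgraph. The path $P$ is maximal in the sense that it is not a proper induced subgraph of a longer induced path of $G$. -}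

module Defs where

open import Data.Nat using (ℕ; suc; _+_; _∸_; _<_; _%_)
open import Data.Fin using (Fin; toℕ; zero; suc)
open import Data.Bool using (Bool; true; false)
open import Data.Product using (Σ; ∃; _×_; _,_)
open import Data.Sum using (_⊎_)
open import Data.Empty using (⊥)
open import Relation.Nullary using (¬_)
open import Relation.Binary.PropositionalEquality using (_≡_; _≢_)
open import Function.Bundles using (_⇔_)

record Graph : Set where
  field
    n     : ℕ
    adj   : Fin n → Fin n → Bool
    adj-sym    : ∀ u v → adj u v ≡ adj v u
    adj-irrefl : ∀ v → adj v v ≡ false

module _ (G : Graph) where
  open Graph G

  V : Set
  V = Fin n

  E : V → V → Set
  E u v = adj u v ≡ true

  TriangleFree : Set
  TriangleFree = ∀ a b c → E a b → E b c → E a c → ⊥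

  IsInducedPath : {m : ℕ} → (Fin m → V) → Set
  IsInducedPath {m} f =
    (∀ i j → f i ≡ f j → i ≡ j) ×
    (∀ i j → E (f i) (f j) ⇔ (suc (toℕ i) ≡ toℕ j ⊎ suc (toℕ j) ≡ toℕ i))

  IsMaximalInducedPath : {k : ℕ} → (Fin k → V) → Set
  IsMaximalInducedPath {k} P =
    IsInducedPath P ×
    (∀ (m : ℕ) (Q : Fin m → V) → IsInducedPath Q →
       (∀ i → ∃ λ j → P i ≡ Q j) →
       ¬ (∃ λ j → ∀ i → Q j ≢ P i))

T123-edge : Fin 7 → Fin 7 → Bool
T123-edge i j = go (toℕ i) (toℕ j)
  where
  e : ℕ → ℕ → Bool
  e 0 1 = true
  e 0 2 = true
  e 2 3 = true
  e 0 4 = true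
  e 4 5 = true
  e 5 6 = true
  e _ _ = false
  go : ℕ → ℕ → Bool
  go x y with e x y
  ... | true  = true
  ... | false = e y x

module _ (G : Graph) where
  HasInducedT123 : Set
  HasInducedT123 = Σ (Fin 7 → V G) λ f →
    (∀ i j → f i ≡ f j → i ≡ j) ×
    (∀ i j → E G (f i) (f j) ⇔ (T123-edge i j ≡ true))

  -- N(v) ∩ V(P) = { P i | S i }   (indices are 0-based: P zero is p_1)
  NbrOnPathIs : {k : ℕ} → (Fin k → V G) → V G → (ℕ → Set) → Set
  NbrOnPathIs {k} P v S = ∀ (i : Fin k) → E G v (P i) ⇔ S (toℕ i)

module Submission where

open import Defs
open import Data.Bool using (Bool; true; false; T; not; _∨_)
open import Data.Bool.Properties using (T-≡; ¬-not; ∨-identityʳ; ∨-zeroʳ) renaming (_≟_ to _≟ᵇ_)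
open import Data.Empty using (⊥; ⊥-elim)
open import Data.Fin using (Fin; zero; suc; toℕ; fromℕ; fromℕ<; inject₁; #_)
open import Data.Fin.Properties
  using (toℕ<n; toℕ-fromℕ; toℕ-fromℕ<; fromℕ<-toℕ; fromℕ<-cong; toℕ-inject₁; all?; any?)
  renaming (_≟_ to _≟ᶠ_)
open import Data.Fin.Relation.Unary.Top using (view; ‵fromℕ; ‵inject₁; view-fromℕ; view-inject₁)
open import Data.Fin.Subset using (Subset)
open import Data.Fin.Subset.Properties using (anySubset?)
open import Data.List using (List; []; _∷_)
open import Data.List.Relation.Unary.Any using (Any; satisfied) renaming (any? to anyᴸ?)
open import Data.Maybe using (Maybe; just; nothing; maybe)
open import Data.Nat
  using (ℕ; zero; suc; _+_; _∸_; _≤_; _<_; _≡ᵇ_; _≤ᵇ_; _%_; z≤n; s≤s; s≤s⁻¹; _<?_)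
open import Data.Nat.Properties
  using ( ≡ᵇ⇒≡; ≡⇒≡ᵇ; ≤ᵇ⇒≤; suc-injective; m≢1+n+m; <⇒≢; <⇒≤; ≤-refl; ≤-trans; ≤-<-trans
        ; n≤1+n; m≤n+m; m≤n⇒m<n∨m≡n; +-comm; +-identityʳ; +-mono-≤; +-monoˡ-≤
        ; +-cancelʳ-≡; +-cancelˡ-≤; 1+n≢n)
open import Data.Product using (Σ; ∃; _×_; _,_; proj₁; proj₂)
open import Data.Sum using (_⊎_; inj₁; inj₂; [_,_])
import Data.Sum as Sum
open import Data.Sum.Function.Propositional using (_⊎-cong_)
open import Data.Unit using (⊤)
open import Data.Vec using (Vec; []; _∷_; lookup; map; tabulate)
open import Data.Vec.Functional using () renaming (_∷_ to _◂_)
open import Data.Vec.Properties using (lookup∘tabulate)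
open import Data.Vec.Relation.Unary.All using (All; []; _∷_)
open import Data.Vec.Relation.Unary.All.Properties using (lookup⁺)
open import Function using (_∘_; id)
open import Function.Bundles using (_⇔_; mk⇔; Equivalence)
open import Function.Properties.Equivalence using () renaming (trans to ⇔-trans; sym to ⇔-sym)
open import Relation.Binary.PropositionalEquality
  using (_≡_; _≢_; refl; sym; trans; cong; cong₂; subst; subst₂; ≢-sym)
open import Relation.Nullary using (¬_; Dec; yes; no; contradiction)
open import Relation.Nullary.Decidable
  using (True; toWitness; toWitnessFalse; decidable-stable; ¬?; T?; _×-dec_; _⊎-dec_; _→-dec_)

-- Let N be the set of positions i with v adjacent to p_i. A triangle-free
-- graph has no two consecutive positions in N, and maximality of P excludes
-- N = {0} and N = {k-1}, since then v would extend P. The rest is read off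
-- N from left to right: on every prefix p_0 … p_L with L ≥ 7, N is empty, one
-- of {0}, {1}, {L-1}, {L}, a pair {a, a+2}, the evens, the odds, or {0, L}.
-- For L = 7 this is a finite check over all 2⁸ prefixes. Going from L to L+1,
-- every extension leaving this list puts v and p_L, p_{L+1} in a triangle or
-- exhibits an induced T₁₂₃ on v and six path vertices.

same-truth : ∀ {x y : Bool} → x ≡ y → x ≡ true ⇔ y ≡ true
same-truth x≡y = mk⇔ (trans (sym x≡y)) (trans x≡y)

∨-⇔ : ∀ x y → (x ∨ y) ≡ true ⇔ (x ≡ true ⊎ y ≡ true)
∨-⇔ true  _ = mk⇔ inj₁ (λ _ → refl)
∨-⇔ false _ = mk⇔ inj₂ [ (λ ()) , id ]

≡ᵇ-⇔ : ∀ m n → (m ≡ᵇ n) ≡ true ⇔ m ≡ n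
≡ᵇ-⇔ m n = mk⇔ (≡ᵇ⇒≡ m n ∘ Equivalence.from T-≡) (Equivalence.to T-≡ ∘ ≡⇒≡ᵇ m n)

≡ᵇ-refl : ∀ n → (n ≡ᵇ n) ≡ true
≡ᵇ-refl n = Equivalence.from (≡ᵇ-⇔ n n) refl

≢⇒≡ᵇ-false : ∀ {m n} → m ≢ n → (m ≡ᵇ n) ≡ false
≢⇒≡ᵇ-false m≢n = ¬-not (m≢n ∘ Equivalence.to (≡ᵇ-⇔ _ _))

<⇒≡ᵇ-false : ∀ {m n} → m < n → (m ≡ᵇ n) ≡ false
<⇒≡ᵇ-false = ≢⇒≡ᵇ-false ∘ <⇒≢

>⇒≡ᵇ-false : ∀ {m n} → n < m → (m ≡ᵇ n) ≡ false
>⇒≡ᵇ-false = ≢⇒≡ᵇ-false ∘ ≢-sym ∘ <⇒≢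

≡ᵇ-+ʳ : ∀ c d n → (c + n ≡ᵇ d + n) ≡ (c ≡ᵇ d)
≡ᵇ-+ʳ zero    zero    n = ≡ᵇ-refl n
≡ᵇ-+ʳ zero    (suc d) n = ≢⇒≡ᵇ-false (m≢1+n+m n)
≡ᵇ-+ʳ (suc c) zero    n = ≢⇒≡ᵇ-false (≢-sym (m≢1+n+m n))
≡ᵇ-+ʳ (suc c) (suc d) n = ≡ᵇ-+ʳ c d n

parity-flips : ∀ r n → r < 2 → (suc n % 2 ≡ᵇ r) ≡ not (n % 2 ≡ᵇ r)
parity-flips 0 0 _ = refl
parity-flips 1 0 _ = refl
parity-flips 0 1 _ = refl
parity-flips 1 1 _ = refl
parity-flips r (suc (suc n)) r<2 = parity-flips r n r<2
parity-flips (suc (suc _)) _ (s≤s (s≤s ()))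

consecutive : ℕ → ℕ → Bool
consecutive p q = (suc p ≡ᵇ q) ∨ (suc q ≡ᵇ p)

consecutive-⇔ : ∀ p q → consecutive p q ≡ true ⇔ (suc p ≡ q ⊎ suc q ≡ p)
consecutive-⇔ p q = ⇔-trans (∨-⇔ _ _) (≡ᵇ-⇔ (suc p) q ⊎-cong ≡ᵇ-⇔ (suc q) p)

consecutive-+ʳ : ∀ c d n → consecutive (c + n) (d + n) ≡ consecutive c d
consecutive-+ʳ c d n = cong₂ _∨_ (≡ᵇ-+ʳ (suc c) d n) (≡ᵇ-+ʳ (suc d) c n)

far⇒¬consecutive : ∀ {p q} → 2 + p ≤ q → consecutive p q ≡ false
far⇒¬consecutive 2+p≤q =
  cong₂ _∨_ (<⇒≡ᵇ-false 2+p≤q) (>⇒≡ᵇ-false (s≤s (≤-trans (m≤n+m _ 2) 2+p≤q)))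

-- Templates for induced copies of T₁₂₃

-- A template vertex is the outside vertex v or a path vertex, at position
-- c + U (block A) or c + W (block B) for offsets U ≤ W; block-B vertices must
-- lie at least two positions beyond block-A ones. This way adjacency and
-- equality of template vertices can be evaluated even when the offsets are
-- variables. The Bool records adjacency to v.
data Node : Set where
  outside       : Node
  blockA blockB : ℕ → Bool → Node

modelAdj : Node → Node → Bool
modelAdj outside      outside      = false
modelAdj outside      (blockA _ β) = β
modelAdj outside      (blockB _ β) = β
modelAdj (blockA _ β) outside      = β
modelAdj (blockB _ β) outside      = β
modelAdj (blockA c _) (blockA d _) = consecutive c d
modelAdj (blockB c _) (blockB d _) = consecutive c d
modelAdj (blockA _ _) (blockB _ _) = false
modelAdj (blockB _ _) (blockA _ _) = false

separated : Node → Node → Bool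
separated (blockA c _) (blockB d _) = 2 + c ≤ᵇ d
separated (blockB d _) (blockA c _) = 2 + c ≤ᵇ d
separated _            _            = true

coincide : Node → Node → Bool
coincide outside      outside      = true
coincide (blockA c _) (blockA d _) = c ≡ᵇ d
coincide (blockB c _) (blockB d _) = c ≡ᵇ d
coincide _            _            = false

-- Listed in the order a, …, g of T123-edge: the centre, the short leg, the
-- leg of length two, the leg of length three.
Template : Set
Template = Vec Node 7

FitsT123 : Template → Fin 7 → Fin 7 → Set
FitsT123 t i j =
  T (separated (lookup t i) (lookup t j)) ×
  modelAdj (lookup t i) (lookup t j) ≡ T123-edge i j ×
  (T (coincide (lookup t i) (lookup t j)) → i ≡ j)

IsT123Template : Template → Set
IsT123Template t = ∀ i j → FitsT123 t i j

isT123? : ∀ t → Dec (IsT123Template t)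
isT123? t = all? λ i → all? λ j → T? _ ×-dec (_ ≟ᵇ _) ×-dec (T? _ →-dec (i ≟ᶠ j))

-- Shapes of a neighbourhood on a prefix of the path

data Shape : Set where
  none                         : Shape
  single pair alternate ends : ℕ → Shape

⟦_⟧ : Shape → ℕ → Bool
⟦ none ⟧        p = false
⟦ single a ⟧    p = p ≡ᵇ a
⟦ pair a ⟧      p = (p ≡ᵇ a) ∨ (p ≡ᵇ 2 + a)
⟦ alternate r ⟧ p = p % 2 ≡ᵇ r
⟦ ends r ⟧      p = (p ≡ᵇ 0) ∨ (p ≡ᵇ r)

Valid : Shape → ℕ → Set
Valid none          L = ⊤
Valid (single a)    L = a ≡ 0 ⊎ a ≡ 1 ⊎ suc a ≡ L ⊎ a ≡ L
Valid (pair a)      L = 2 + a ≤ L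
Valid (alternate r) L = r < 2
Valid (ends r)      L = r ≡ L

pair-+ʳ : ∀ c d n → ⟦ pair (d + n) ⟧ (c + n) ≡ ⟦ pair d ⟧ c
pair-+ʳ c d n = cong₂ _∨_ (≡ᵇ-+ʳ c d n) (≡ᵇ-+ʳ c (2 + d) n)

pair-⇔ : ∀ a p → ⟦ pair a ⟧ p ≡ true ⇔ (p ≡ a ⊎ p ≡ a + 2)
pair-⇔ a p = ⇔-trans (∨-⇔ _ _) (≡ᵇ-⇔ p a ⊎-cong ⇔-trans (≡ᵇ-⇔ p (2 + a)) 2+a≡a+2)
  where
    2+a≡a+2 : p ≡ 2 + a ⇔ p ≡ a + 2
    2+a≡a+2 = mk⇔ (λ e → trans e (+-comm 2 a)) (λ e → trans e (+-comm a 2))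

ends-⇔ : ∀ r p → ⟦ ends r ⟧ p ≡ true ⇔ (p ≡ 0 ⊎ p ≡ r)
ends-⇔ r p = ⇔-trans (∨-⇔ _ _) (≡ᵇ-⇔ p 0 ⊎-cong ≡ᵇ-⇔ p r)

Pattern : Set
Pattern = Subset 8

-- `nothing` stands for the outside vertex, `just c` for the path vertex p_c.
Placement : Set
Placement = Vec (Maybe (Fin 8)) 7

place : ∀ {n} → Pattern → Vec (Maybe (Fin 8)) n → Vec Node n
place pat = map (maybe (λ c → blockA (toℕ c) (lookup pat c)) outside)

-- Found by a computer search: together they exhibit a T₁₂₃ in every pattern
-- on eight positions that is not a shape and has no two consecutive neighbours.
placements : List Placement
placements =
    (just (# 2) ∷ just (# 1) ∷ just (# 3) ∷ just (# 4) ∷ nothing ∷ just (# 7) ∷ just (# 6) ∷ [])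
  ∷ (just (# 3) ∷ just (# 4) ∷ just (# 2) ∷ just (# 1) ∷ nothing ∷ just (# 7) ∷ just (# 6) ∷ [])
  ∷ (just (# 4) ∷ just (# 3) ∷ just (# 5) ∷ just (# 6) ∷ nothing ∷ just (# 0) ∷ just (# 1) ∷ [])
  ∷ (just (# 5) ∷ just (# 4) ∷ just (# 6) ∷ just (# 7) ∷ nothing ∷ just (# 0) ∷ just (# 1) ∷ [])
  ∷ (just (# 1) ∷ just (# 0) ∷ just (# 2) ∷ just (# 3) ∷ nothing ∷ just (# 7) ∷ just (# 6) ∷ [])
  ∷ (just (# 6) ∷ just (# 7) ∷ just (# 5) ∷ just (# 4) ∷ nothing ∷ just (# 0) ∷ just (# 1) ∷ [])
  ∷ (just (# 1) ∷ just (# 0) ∷ just (# 2) ∷ just (# 3) ∷ nothing ∷ just (# 6) ∷ just (# 5) ∷ [])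
  ∷ (just (# 3) ∷ nothing ∷ just (# 4) ∷ just (# 5) ∷ just (# 2) ∷ just (# 1) ∷ just (# 0) ∷ [])
  ∷ (just (# 2) ∷ just (# 3) ∷ just (# 1) ∷ just (# 0) ∷ nothing ∷ just (# 6) ∷ just (# 5) ∷ [])
  ∷ (just (# 5) ∷ just (# 4) ∷ just (# 6) ∷ just (# 7) ∷ nothing ∷ just (# 1) ∷ just (# 2) ∷ [])
  ∷ (just (# 4) ∷ nothing ∷ just (# 3) ∷ just (# 2) ∷ just (# 5) ∷ just (# 6) ∷ just (# 7) ∷ [])
  ∷ (nothing ∷ just (# 4) ∷ just (# 6) ∷ just (# 7) ∷ just (# 0) ∷ just (# 1) ∷ just (# 2) ∷ [])
  ∷ (just (# 6) ∷ just (# 7) ∷ just (# 5) ∷ just (# 4) ∷ nothing ∷ just (# 1) ∷ just (# 0) ∷ [])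
  ∷ (just (# 5) ∷ just (# 6) ∷ just (# 4) ∷ just (# 3) ∷ nothing ∷ just (# 0) ∷ just (# 1) ∷ [])
  ∷ (just (# 5) ∷ just (# 4) ∷ just (# 6) ∷ just (# 7) ∷ nothing ∷ just (# 2) ∷ just (# 1) ∷ [])
  ∷ (just (# 2) ∷ nothing ∷ just (# 1) ∷ just (# 0) ∷ just (# 3) ∷ just (# 4) ∷ just (# 5) ∷ [])
  ∷ (nothing ∷ just (# 7) ∷ just (# 1) ∷ just (# 0) ∷ just (# 3) ∷ just (# 4) ∷ just (# 5) ∷ [])
  ∷ (nothing ∷ just (# 4) ∷ just (# 7) ∷ just (# 6) ∷ just (# 2) ∷ just (# 1) ∷ just (# 0) ∷ [])
  ∷ (just (# 5) ∷ nothing ∷ just (# 6) ∷ just (# 7) ∷ just (# 4) ∷ just (# 3) ∷ just (# 2) ∷ [])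
  ∷ (just (# 3) ∷ nothing ∷ just (# 2) ∷ just (# 1) ∷ just (# 4) ∷ just (# 5) ∷ just (# 6) ∷ [])
  ∷ (just (# 4) ∷ just (# 5) ∷ nothing ∷ just (# 7) ∷ just (# 3) ∷ just (# 2) ∷ just (# 1) ∷ [])
  ∷ []

shapes₇ : List (Σ Shape λ s → Valid s 7)
shapes₇ =
    (none , _) ∷ (alternate 0 , ≤ᵇ⇒≤ _ _ _) ∷ (alternate 1 , ≤ᵇ⇒≤ _ _ _) ∷ (ends 7 , refl)
  ∷ (single 0 , inj₁ refl) ∷ (single 1 , inj₂ (inj₁ refl))
  ∷ (single 6 , inj₂ (inj₂ (inj₁ refl))) ∷ (single 7 , inj₂ (inj₂ (inj₂ refl)))
  ∷ (pair 0 , ≤ᵇ⇒≤ _ _ _) ∷ (pair 1 , ≤ᵇ⇒≤ _ _ _) ∷ (pair 2 , ≤ᵇ⇒≤ _ _ _)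
  ∷ (pair 3 , ≤ᵇ⇒≤ _ _ _) ∷ (pair 4 , ≤ᵇ⇒≤ _ _ _) ∷ (pair 5 , ≤ᵇ⇒≤ _ _ _)
  ∷ []

Explained : Pattern → Set
Explained pat =
  (∃ λ (j : Fin 7) → T (lookup pat (inject₁ j)) × T (lookup pat (suc j)))
  ⊎ Any (λ s → ∀ (j : Fin 8) → lookup pat j ≡ ⟦ proj₁ s ⟧ (toℕ j)) shapes₇
  ⊎ Any (IsT123Template ∘ place pat) placements

explained? : ∀ pat → Dec (Explained pat)
explained? pat =
  any? (λ j → T? _ ×-dec T? _)
  ⊎-dec anyᴸ? (λ s → all? λ j → _ ≟ᵇ _) shapes₇
  ⊎-dec anyᴸ? (isT123? ∘ place pat) placements

every-pattern-explained : ∀ pat → Explained pat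
every-pattern-explained pat =
  decidable-stable (explained? pat)
    (λ ¬explained → toWitnessFalse {a? = anySubset? (¬? ∘ explained?)} _ (pat , ¬explained))

-- Classification of prefixes

-- b p is to be read as "the outside vertex is adjacent to p_p".
module NeighbourPattern (k : ℕ) (b : ℕ → Bool) where

  Fact : Bool → ℕ → Set
  Fact β p = p < k × b p ≡ β

  Holds : ℕ → ℕ → Node → Set
  Holds U W outside      = ⊤
  Holds U W (blockA c β) = Fact β (c + U)
  Holds U W (blockB c β) = Fact β (c + W)

  NoConsecutive : Set
  NoConsecutive = ∀ p → suc p < k → b p ≡ true → b (suc p) ≡ true → ⊥

  T123Free : Set
  T123Free = ∀ {U W} → U ≤ W → (t : Template) → IsT123Template t → All (Holds U W) t → ⊥

  Agree : ℕ → (ℕ → Bool) → Set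
  Agree L f = ∀ p → p ≤ L → b p ≡ f p

  Class : ℕ → Set
  Class L = Σ Shape λ s → Valid s L × Agree L ⟦ s ⟧

  prefix : Pattern
  prefix = tabulate (b ∘ toℕ)

  prefix-bit : ∀ i → lookup prefix i ≡ b (toℕ i)
  prefix-bit = lookup∘tabulate (b ∘ toℕ)

  placed-holds : 7 < k → ∀ {n} (pl : Vec (Maybe (Fin 8)) n) → All (Holds 0 0) (place prefix pl)
  placed-holds 7<k []             = []
  placed-holds 7<k (nothing ∷ pl) = _ ∷ placed-holds 7<k pl
  placed-holds 7<k (just c ∷ pl)  =
    subst (Fact (lookup prefix c)) (sym (+-identityʳ (toℕ c))) (≤-trans (toℕ<n c) 7<k , sym (prefix-bit c))
    ∷ placed-holds 7<k pl

  agree-on-Fin : ∀ {L f} → (∀ (i : Fin (suc L)) → b (toℕ i) ≡ f (toℕ i)) → Agree L f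
  agree-on-Fin {f = f} agree p p≤L =
    subst (λ q → b q ≡ f q) (toℕ-fromℕ< (s≤s p≤L)) (agree (fromℕ< (s≤s p≤L)))

  module Classification (no-consecutive : NoConsecutive) (t123-free : T123Free) where

    excluded : ∀ {U W} → U ≤ W → (t : Template) → {True (isT123? t)} → All (Holds U W) t → ⊥
    excluded U≤W t {fits} = t123-free U≤W t (toWitness fits)

    base : 7 < k → Class 7
    base 7<k = from-explained (every-pattern-explained prefix)
      where
        from-explained : Explained prefix → Class 7
        from-explained (inj₁ (j , bj , bj+1)) =
          ⊥-elim (no-consecutive (toℕ j) (≤-trans (s≤s (toℕ<n j)) 7<k)
            (trans (cong b (sym (toℕ-inject₁ j))) (trans (sym (prefix-bit (inject₁ j))) (Equivalence.to T-≡ bj)))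
            (trans (sym (prefix-bit (suc j))) (Equivalence.to T-≡ bj+1)))
        from-explained (inj₂ (inj₁ matches)) =
          let (s , valid) , agree = satisfied matches
          in s , valid , agree-on-Fin (λ i → trans (sym (prefix-bit i)) (agree i))
        from-explained (inj₂ (inj₂ placed)) =
          let placement , fits = satisfied placed
          in ⊥-elim (t123-free z≤n (place prefix placement) fits (placed-holds 7<k placement))

    module Step (m : ℕ) (8+m<k : 8 + m < k) where

      earlier : ∀ {f p β} → Agree (7 + m) f → p ≤ 7 + m → f p ≡ β → Fact β p
      earlier agree p≤L fp≡β = ≤-<-trans p≤L (<⇒≤ 8+m<k) , trans (agree _ p≤L) fp≡β

      at : ∀ {f β U} c {_ : T (c ≤ᵇ 7)} → U ≤ m → Agree (7 + m) f → f (c + U) ≡ β → Fact β (c + U)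
      at c {c≤7} U≤m agree = earlier agree (+-mono-≤ (≤ᵇ⇒≤ c 7 c≤7) U≤m)

      latest : ∀ {β} → b (8 + m) ≡ β → Fact β (8 + m)
      latest = 8+m<k ,_

      triangle : b (7 + m) ≡ true → b (8 + m) ≡ true → ⊥
      triangle = no-consecutive (7 + m) 8+m<k

      extend : ∀ {f g} → Agree (7 + m) f → b (8 + m) ≡ g (8 + m) →
               (∀ p → p ≤ 7 + m → f p ≡ g p) → Agree (8 + m) g
      extend agree new below p p≤ with m≤n⇒m<n∨m≡n p≤
      ... | inj₁ p<  = trans (agree p (s≤s⁻¹ p<)) (below p (s≤s⁻¹ p<))
      ... | inj₂ refl = new

      keep : ∀ {f} → Agree (7 + m) f → b (8 + m) ≡ f (8 + m) → Agree (8 + m) f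
      keep agree new = extend agree new (λ _ _ → refl)

      add-latest : ∀ {f} → Agree (7 + m) f → b (8 + m) ≡ true → Agree (8 + m) (λ p → f p ∨ (p ≡ᵇ 8 + m))
      add-latest {f} agree new = extend agree
        (trans new (sym (trans (cong (f (8 + m) ∨_) (≡ᵇ-refl (8 + m))) (∨-zeroʳ _))))
        (λ p p≤ → sym (trans (cong (f p ∨_) (<⇒≡ᵇ-false (s≤s p≤))) (∨-identityʳ _)))

      second-and-latest : Agree (7 + m) ⟦ single 1 ⟧ → b (8 + m) ≡ true → ⊥
      second-and-latest agree new = excluded {0} {m} z≤n
        (blockA 1 true ∷ blockA 0 false ∷ outside ∷ blockB 8 true
          ∷ blockA 2 false ∷ blockA 3 false ∷ blockA 4 false ∷ [])
        (at 1 z≤n agree refl ∷ at 0 z≤n agree refl ∷ _ ∷ latest new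
          ∷ at 2 z≤n agree refl ∷ at 3 z≤n agree refl ∷ at 4 z≤n agree refl ∷ [])

      penultimate-without-latest : Agree (7 + m) ⟦ single (6 + m) ⟧ → b (8 + m) ≡ false → ⊥
      penultimate-without-latest agree new = excluded {m} {m} ≤-refl
        (blockA 6 true ∷ outside ∷ blockA 7 false ∷ blockA 8 false
          ∷ blockA 5 false ∷ blockA 4 false ∷ blockA 3 false ∷ [])
        (known 6 ∷ _ ∷ known 7 ∷ latest new
          ∷ known 5 ∷ known 4 ∷ known 3 ∷ [])
        where
          known : ∀ c {_ : T (c ≤ᵇ 7)} → Fact (c ≡ᵇ 6) (c + m)
          known c {c≤7} = at c {c≤7} ≤-refl agree (≡ᵇ-+ʳ c 6 m)

      alternation-broken : ∀ r → r < 2 → (m % 2 ≡ᵇ r) ≡ true →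
                           Agree (7 + m) ⟦ alternate r ⟧ → b (8 + m) ≡ false → ⊥
      alternation-broken r r<2 parity agree new = excluded {m} {m} ≤-refl
        (blockA 6 true ∷ blockA 5 false ∷ blockA 7 false ∷ blockA 8 false
          ∷ outside ∷ blockA 2 true ∷ blockA 3 false ∷ [])
        (at 6 ≤-refl agree parity ∷ at 5 ≤-refl agree odd ∷ at 7 ≤-refl agree odd ∷ latest new
          ∷ _ ∷ at 2 ≤-refl agree parity ∷ at 3 ≤-refl agree odd ∷ [])
        where
          odd : (suc m % 2 ≡ᵇ r) ≡ false
          odd = trans (parity-flips r m r<2) (cong not parity)

      ends-without-latest : Agree (7 + m) ⟦ ends (7 + m) ⟧ → b (8 + m) ≡ false → ⊥
      ends-without-latest agree new = excluded {0} {m} z≤n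
        (blockB 7 true ∷ blockB 8 false ∷ outside ∷ blockA 0 true
          ∷ blockB 6 false ∷ blockB 5 false ∷ blockB 4 false ∷ [])
        (at 7 ≤-refl agree (≡ᵇ-+ʳ 7 7 m) ∷ latest new ∷ _ ∷ at 0 z≤n agree refl
          ∷ at 6 ≤-refl agree (≡ᵇ-+ʳ 6 7 m) ∷ at 5 ≤-refl agree (≡ᵇ-+ʳ 5 7 m)
          ∷ at 4 ≤-refl agree (≡ᵇ-+ʳ 4 7 m) ∷ [])

      pair-low-and-latest : ∀ a → a ≤ 1 → Agree (7 + m) ⟦ pair a ⟧ → b (8 + m) ≡ true → ⊥
      pair-low-and-latest a a≤1 agree new = excluded a≤1+m
        (blockA 2 true ∷ blockA 1 false ∷ outside ∷ blockB 7 true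
          ∷ blockA 3 false ∷ blockA 4 false ∷ blockA 5 false ∷ [])
        (known 2 ∷ known 1 ∷ _ ∷ latest new
          ∷ known 3 ∷ known 4 ∷ known 5 ∷ [])
        where
          a≤1+m : a ≤ 1 + m
          a≤1+m = ≤-trans a≤1 (s≤s z≤n)
          known : ∀ c {_ : T (c ≤ᵇ 6)} → Fact (⟦ pair 0 ⟧ c) (c + a)
          known c {c≤6} = earlier agree (+-mono-≤ (≤ᵇ⇒≤ c 6 c≤6) a≤1+m) (pair-+ʳ c 0 a)

      pair-high-and-latest : ∀ u → 5 + u ≤ 7 + m → Agree (7 + m) ⟦ pair (2 + u) ⟧ → b (8 + m) ≡ true → ⊥
      pair-high-and-latest u 5+u≤L agree new = excluded {u} {2 + m} (+-cancelˡ-≤ 5 u (2 + m) 5+u≤L)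
        (blockA 2 true ∷ blockA 3 false ∷ blockA 1 false ∷ blockA 0 false
          ∷ outside ∷ blockB 6 true ∷ blockB 5 false ∷ [])
        (known 2 ∷ known 3 ∷ known 1 ∷ known 0
          ∷ _ ∷ latest new ∷ earlier agree ≤-refl (cong₂ _∨_ (>⇒≡ᵇ-false 2+u<L) (>⇒≡ᵇ-false 5+u≤L)) ∷ [])
        where
          2+u<L : 2 + u < 7 + m
          2+u<L = ≤-trans (+-monoˡ-≤ u (≤ᵇ⇒≤ 3 5 _)) 5+u≤L
          known : ∀ c {_ : T (c ≤ᵇ 5)} → Fact (⟦ pair 2 ⟧ c) (c + u)
          known c {c≤5} = earlier agree (≤-trans (+-monoˡ-≤ u (≤ᵇ⇒≤ c 5 c≤5)) 5+u≤L) (pair-+ʳ c 2 u)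

      pair-and-latest : ∀ a → 3 + a ≤ 7 + m → Agree (7 + m) ⟦ pair a ⟧ → b (8 + m) ≡ true → ⊥
      pair-and-latest 0             _     = pair-low-and-latest 0 z≤n
      pair-and-latest 1             _     = pair-low-and-latest 1 ≤-refl
      pair-and-latest (suc (suc u)) 5+u≤L = pair-high-and-latest u 5+u≤L

      step-shape : ∀ s → Valid s (7 + m) → Agree (7 + m) ⟦ s ⟧ → ∀ β → b (8 + m) ≡ β → Class (8 + m)
      step-shape none _ agree true  new = single (8 + m) , inj₂ (inj₂ (inj₂ refl)) , add-latest agree new
      step-shape none _ agree false new = none , _ , keep agree new
      step-shape (single .0) (inj₁ refl) agree true  new = ends (8 + m) , refl , add-latest agree new
      step-shape (single .0) (inj₁ refl) agree false new = single 0 , inj₁ refl , keep agree new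
      step-shape (single .1) (inj₂ (inj₁ refl)) agree true  new = ⊥-elim (second-and-latest agree new)
      step-shape (single .1) (inj₂ (inj₁ refl)) agree false new = single 1 , inj₂ (inj₁ refl) , keep agree new
      step-shape (single .(6 + m)) (inj₂ (inj₂ (inj₁ refl))) agree true  new = pair (6 + m) , ≤-refl , add-latest agree new
      step-shape (single .(6 + m)) (inj₂ (inj₂ (inj₁ refl))) agree false new = ⊥-elim (penultimate-without-latest agree new)
      step-shape (single .(7 + m)) (inj₂ (inj₂ (inj₂ refl))) agree true  new =
        ⊥-elim (triangle (trans (agree _ ≤-refl) (≡ᵇ-refl (7 + m))) new)
      step-shape (single .(7 + m)) (inj₂ (inj₂ (inj₂ refl))) agree false new =
        single (7 + m) , inj₂ (inj₂ (inj₁ refl)) , keep agree (trans new (sym (>⇒≡ᵇ-false (≤-refl {8 + m}))))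
      step-shape (pair a) 2+a≤L agree false new =
        pair a , ≤-trans 2+a≤L (n≤1+n _) ,
        keep agree (trans new (sym (cong₂ _∨_ (>⇒≡ᵇ-false (s≤s (≤-trans (m≤n+m a 2) 2+a≤L)))
                                              (>⇒≡ᵇ-false (s≤s 2+a≤L)))))
      step-shape (pair a) 2+a≤L agree true new with m≤n⇒m<n∨m≡n 2+a≤L
      ... | inj₁ 3+a≤L = ⊥-elim (pair-and-latest a 3+a≤L agree new)
      ... | inj₂ 2+a≡L = ⊥-elim (triangle (subst (λ p → b p ≡ true) 2+a≡L right) new)
        where
          right : b (2 + a) ≡ true
          right = trans (agree _ 2+a≤L) (trans (cong ((2 + a ≡ᵇ a) ∨_) (≡ᵇ-refl (2 + a))) (∨-zeroʳ _))
      step-shape (alternate r) r<2 agree β new with m % 2 ≡ᵇ r in parity | β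
      ... | true  | true  = alternate r , r<2 , keep agree (trans new (sym parity))
      ... | true  | false = ⊥-elim (alternation-broken r r<2 parity agree new)
      ... | false | true  = ⊥-elim (triangle (trans (agree _ ≤-refl) (trans (parity-flips r m r<2) (cong not parity))) new)
      ... | false | false = alternate r , r<2 , keep agree (trans new (sym parity))
      step-shape (ends .(7 + m)) refl agree true  new = ⊥-elim (triangle (trans (agree _ ≤-refl) (≡ᵇ-refl (7 + m))) new)
      step-shape (ends .(7 + m)) refl agree false new = ⊥-elim (ends-without-latest agree new)

      step : Class (7 + m) → Class (8 + m)
      step (s , valid , agree) = step-shape s valid agree (b (8 + m)) refl

    classify : ∀ m → 7 + m < k → Class (7 + m)
    classify zero    7<k   = base 7<k
    classify (suc m) 8+m<k = Step.step m 8+m<k (classify m (<⇒≤ 8+m<k))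

-- Neighbourhoods along an induced path

module OnPath (G : Graph) {k : ℕ} (P : Fin k → V G) (induced : IsInducedPath G P)
              (v : V G) (v∉P : ∀ i → v ≢ P i) where

  open Graph G

  flip-adj : ∀ {x y} {A : Set} → E G x y ⇔ A → E G y x ⇔ A
  flip-adj {x} {y} = ⇔-trans (same-truth (adj-sym y x))

  pathAt : ∀ {p} → p < k → V G
  pathAt p<k = P (fromℕ< p<k)

  pathAt-adj : ∀ {p q} (p<k : p < k) (q<k : q < k) →
               E G (pathAt p<k) (pathAt q<k) ⇔ consecutive p q ≡ true
  pathAt-adj {p} {q} p<k q<k =
    ⇔-trans (proj₂ induced (fromℕ< p<k) (fromℕ< q<k))
      (subst₂ (λ x y → (suc x ≡ y ⊎ suc y ≡ x) ⇔ consecutive p q ≡ true)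
        (sym (toℕ-fromℕ< p<k)) (sym (toℕ-fromℕ< q<k)) (⇔-sym (consecutive-⇔ p q)))

  pathAt-injective : ∀ {p q} (p<k : p < k) (q<k : q < k) → pathAt p<k ≡ pathAt q<k → p ≡ q
  pathAt-injective p<k q<k same =
    trans (sym (toℕ-fromℕ< p<k)) (trans (cong toℕ (proj₁ induced _ _ same)) (toℕ-fromℕ< q<k))

  -- false beyond the end of the path
  nbr : ℕ → Bool
  nbr p with p <? k
  ... | yes p<k = adj v (pathAt p<k)
  ... | no  _   = false

  nbr-pathAt : ∀ {p} (p<k : p < k) → nbr p ≡ adj v (pathAt p<k)
  nbr-pathAt {p} p<k with p <? k
  ... | yes p<k′ = cong (adj v ∘ P) (fromℕ<-cong p p refl p<k′ p<k)
  ... | no  p≮k  = contradiction p<k p≮k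

  nbr-toℕ : ∀ i → nbr (toℕ i) ≡ adj v (P i)
  nbr-toℕ i = trans (nbr-pathAt (toℕ<n i)) (cong (adj v ∘ P) (fromℕ<-toℕ i (toℕ<n i)))

  outside-adj : ∀ {p β} (p<k : p < k) → nbr p ≡ β → E G v (pathAt p<k) ⇔ β ≡ true
  outside-adj p<k bit = same-truth (trans (sym (nbr-pathAt p<k)) bit)

  open NeighbourPattern k nbr

  module Realise {U W : ℕ} (U≤W : U ≤ W) where

    vertex : ∀ n → Holds U W n → V G
    vertex outside      _         = v
    vertex (blockA _ _) (p<k , _) = pathAt p<k
    vertex (blockB _ _) (p<k , _) = pathAt p<k

    spread : ∀ c d → T (2 + c ≤ᵇ d) → 2 + (c + U) ≤ d + W
    spread c d s = +-mono-≤ (≤ᵇ⇒≤ (2 + c) d s) U≤W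

    shifted : ∀ {c d} n (p<k : c + n < k) (q<k : d + n < k) →
              E G (pathAt p<k) (pathAt q<k) ⇔ consecutive c d ≡ true
    shifted {c} {d} n p<k q<k = ⇔-trans (pathAt-adj p<k q<k) (same-truth (consecutive-+ʳ c d n))

    far : ∀ c d (p<k : c + U < k) (q<k : d + W < k) → T (2 + c ≤ᵇ d) →
          E G (pathAt p<k) (pathAt q<k) ⇔ false ≡ true
    far c d p<k q<k s = ⇔-trans (pathAt-adj p<k q<k) (same-truth (far⇒¬consecutive (spread c d s)))

    vertex-adj : ∀ n n′ (h : Holds U W n) (h′ : Holds U W n′) → T (separated n n′) →
                 E G (vertex n h) (vertex n′ h′) ⇔ modelAdj n n′ ≡ true
    vertex-adj outside      outside      _         _         _ = same-truth (adj-irrefl v)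
    vertex-adj outside      (blockA _ _) _         (q<k , β) _ = outside-adj q<k β
    vertex-adj outside      (blockB _ _) _         (q<k , β) _ = outside-adj q<k β
    vertex-adj (blockA _ _) outside      (p<k , β) _         _ = flip-adj (outside-adj p<k β)
    vertex-adj (blockB _ _) outside      (p<k , β) _         _ = flip-adj (outside-adj p<k β)
    vertex-adj (blockA _ _) (blockA _ _) (p<k , _) (q<k , _) _ = shifted U p<k q<k
    vertex-adj (blockB _ _) (blockB _ _) (p<k , _) (q<k , _) _ = shifted W p<k q<k
    vertex-adj (blockA c _) (blockB d _) (p<k , _) (q<k , _) s = far c d p<k q<k s
    vertex-adj (blockB d _) (blockA c _) (q<k , _) (p<k , _) s = flip-adj (far c d p<k q<k s)

    vertex-coincide : ∀ n n′ (h : Holds U W n) (h′ : Holds U W n′) → T (separated n n′) →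
                      vertex n h ≡ vertex n′ h′ → T (coincide n n′)
    vertex-coincide outside      outside      _         _         _ _    = _
    vertex-coincide outside      (blockA _ _) _         _         _ same = ⊥-elim (v∉P _ same)
    vertex-coincide outside      (blockB _ _) _         _         _ same = ⊥-elim (v∉P _ same)
    vertex-coincide (blockA _ _) outside      _         _         _ same = ⊥-elim (v∉P _ (sym same))
    vertex-coincide (blockB _ _) outside      _         _         _ same = ⊥-elim (v∉P _ (sym same))
    vertex-coincide (blockA c _) (blockA d _) (p<k , _) (q<k , _) _ same =
      ≡⇒≡ᵇ c d (+-cancelʳ-≡ U c d (pathAt-injective p<k q<k same))
    vertex-coincide (blockB c _) (blockB d _) (p<k , _) (q<k , _) _ same =
      ≡⇒≡ᵇ c d (+-cancelʳ-≡ W c d (pathAt-injective p<k q<k same))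
    vertex-coincide (blockA c _) (blockB d _) (p<k , _) (q<k , _) s same =
      <⇒≢ (≤-trans (n≤1+n _) (spread c d s)) (pathAt-injective p<k q<k same)
    vertex-coincide (blockB d _) (blockA c _) (q<k , _) (p<k , _) s same =
      <⇒≢ (≤-trans (n≤1+n _) (spread c d s)) (pathAt-injective p<k q<k (sym same))

    realise : (t : Template) → IsT123Template t → All (Holds U W) t → HasInducedT123 G
    realise t fits holds = embed , embed-injective , embed-adj
      where
        embed : Fin 7 → V G
        embed i = vertex (lookup t i) (lookup⁺ holds i)

        embed-injective : ∀ i j → embed i ≡ embed j → i ≡ j
        embed-injective i j same =
          proj₂ (proj₂ (fits i j)) (vertex-coincide _ _ (lookup⁺ holds i) (lookup⁺ holds j) (proj₁ (fits i j)) same)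

        embed-adj : ∀ i j → E G (embed i) (embed j) ⇔ T123-edge i j ≡ true
        embed-adj i j =
          ⇔-trans (vertex-adj _ _ (lookup⁺ holds i) (lookup⁺ holds j) (proj₁ (fits i j)))
            (same-truth (proj₁ (proj₂ (fits i j))))

  t123-free : ¬ HasInducedT123 G → T123Free
  t123-free no-t123 U≤W t fits holds = no-t123 (Realise.realise U≤W t fits holds)

  no-consecutive : TriangleFree G → NoConsecutive
  no-consecutive triangle-free p 1+p<k bp b1+p =
    triangle-free v (pathAt p<k) (pathAt 1+p<k)
      (Equivalence.from (outside-adj p<k bp) refl)
      (Equivalence.from (pathAt-adj p<k 1+p<k) (Equivalence.from (consecutive-⇔ p (suc p)) (inj₁ refl)))
      (Equivalence.from (outside-adj 1+p<k b1+p) refl)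
    where
      p<k : p < k
      p<k = <⇒≤ 1+p<k

  neighbourhood : ∀ {L f S} → k ≤ suc L → Agree L f → (∀ p → f p ≡ true ⇔ S p) → NbrOnPathIs G P v S
  neighbourhood k≤1+L agree reflects i =
    ⇔-trans (same-truth (trans (sym (nbr-toℕ i)) (agree (toℕ i) (s≤s⁻¹ (≤-trans (toℕ<n i) k≤1+L)))))
      (reflects (toℕ i))

  prepend-induced : NbrOnPathIs G P v (_≡ 0) → IsInducedPath G (v ◂ P)
  prepend-induced only-first = injective , adjacent
    where
      injective : ∀ i j → (v ◂ P) i ≡ (v ◂ P) j → i ≡ j
      injective zero    zero    _    = refl
      injective zero    (suc j) same = ⊥-elim (v∉P j same)
      injective (suc i) zero    same = ⊥-elim (v∉P i (sym same))
      injective (suc i) (suc j) same = cong suc (proj₁ induced i j same)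

      adjacent : ∀ i j → E G ((v ◂ P) i) ((v ◂ P) j) ⇔ (suc (toℕ i) ≡ toℕ j ⊎ suc (toℕ j) ≡ toℕ i)
      adjacent zero    zero    = ⇔-trans (same-truth (adj-irrefl v)) (mk⇔ (λ ()) λ { (inj₁ ()) ; (inj₂ ()) })
      adjacent zero    (suc j) = ⇔-trans (only-first j)
        (mk⇔ (inj₁ ∘ cong suc ∘ sym) λ { (inj₁ e) → sym (suc-injective e) ; (inj₂ ()) })
      adjacent (suc i) zero    = ⇔-trans (flip-adj (only-first i))
        (mk⇔ (inj₂ ∘ cong suc ∘ sym) λ { (inj₂ e) → sym (suc-injective e) ; (inj₁ ()) })
      adjacent (suc i) (suc j) = ⇔-trans (proj₂ induced i j)
        (mk⇔ (Sum.map (cong suc) (cong suc)) (Sum.map suc-injective suc-injective))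

  append : Fin (suc k) → V G
  append i with view i
  ... | ‵fromℕ     = v
  ... | ‵inject₁ j = P j

  append-fromℕ : append (fromℕ k) ≡ v
  append-fromℕ rewrite view-fromℕ k = refl

  append-inject₁ : ∀ i → append (inject₁ i) ≡ P i
  append-inject₁ i rewrite view-inject₁ i = refl

  append-induced : NbrOnPathIs G P v (λ p → suc p ≡ k) → IsInducedPath G append
  append-induced only-last = injective , adjacent
    where
      beyond : ∀ (j : Fin k) → suc k ≢ toℕ j
      beyond j e = <⇒≢ (≤-trans (toℕ<n j) (n≤1+n k)) (sym e)

      injective : ∀ i j → append i ≡ append j → i ≡ j
      injective i j with view i | view j
      ... | ‵fromℕ     | ‵fromℕ     = λ _ → refl
      ... | ‵fromℕ     | ‵inject₁ j = ⊥-elim ∘ v∉P j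
      ... | ‵inject₁ i | ‵fromℕ     = ⊥-elim ∘ v∉P i ∘ sym
      ... | ‵inject₁ i | ‵inject₁ j = cong inject₁ ∘ proj₁ induced i j

      adjacent : ∀ i j → E G (append i) (append j) ⇔ (suc (toℕ i) ≡ toℕ j ⊎ suc (toℕ j) ≡ toℕ i)
      adjacent i j with view i | view j
      ... | ‵fromℕ | ‵fromℕ =
        ⇔-trans (same-truth (adj-irrefl v)) (mk⇔ (λ ()) [ ⊥-elim ∘ 1+n≢n , ⊥-elim ∘ 1+n≢n ])
      ... | ‵fromℕ | ‵inject₁ j rewrite toℕ-fromℕ k | toℕ-inject₁ j =
        ⇔-trans (only-last j) (mk⇔ inj₂ λ { (inj₁ e) → ⊥-elim (beyond j e) ; (inj₂ e) → e })
      ... | ‵inject₁ i | ‵fromℕ rewrite toℕ-fromℕ k | toℕ-inject₁ i =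
        ⇔-trans (flip-adj (only-last i)) (mk⇔ inj₁ λ { (inj₂ e) → ⊥-elim (beyond i e) ; (inj₁ e) → e })
      ... | ‵inject₁ i | ‵inject₁ j rewrite toℕ-inject₁ i | toℕ-inject₁ j = proj₂ induced i j

  module _ (maximal : IsMaximalInducedPath G P) where

    not-only-first : ¬ NbrOnPathIs G P v (_≡ 0)
    not-only-first only-first =
      proj₂ maximal (suc k) (v ◂ P) (prepend-induced only-first) (λ i → suc i , refl) (zero , v∉P)

    not-only-last : ¬ NbrOnPathIs G P v (λ p → suc p ≡ k)
    not-only-last only-last =
      proj₂ maximal (suc k) append (append-induced only-last)
        (λ i → inject₁ i , sym (append-inject₁ i))
        (fromℕ k , λ i → v∉P i ∘ trans (sym append-fromℕ))

AllowedNeighbourhood : (G : Graph) {k : ℕ} → (Fin k → V G) → V G → Set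
AllowedNeighbourhood G {k} P v =
      NbrOnPathIs G P v (λ _ → ⊥)
      ⊎ (NbrOnPathIs G P v (λ j → j ≡ 1) ⊎ NbrOnPathIs G P v (λ j → j ≡ k ∸ 2))
      ⊎ (∃ λ a → a + 2 < k × NbrOnPathIs G P v (λ j → j ≡ a ⊎ j ≡ a + 2))
      ⊎ NbrOnPathIs G P v (λ j → j % 2 ≡ 0)
      ⊎ NbrOnPathIs G P v (λ j → j % 2 ≡ 1)
      ⊎ NbrOnPathIs G P v (λ j → j ≡ 0 ⊎ j ≡ k ∸ 1)

module _ (G : Graph) (m : ℕ) (P : Fin (8 + m) → V G) (maximal : IsMaximalInducedPath G P)
         (v : V G) (v∉P : ∀ i → v ≢ P i) where

  open OnPath G P (proj₁ maximal) v v∉P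
  open NeighbourPattern (8 + m) nbr

  class-allowed : Class (7 + m) → AllowedNeighbourhood G P v
  class-allowed (none , _ , agree) =
    inj₁ (neighbourhood ≤-refl agree λ _ → mk⇔ (λ ()) λ ())
  class-allowed (single .0 , inj₁ refl , agree) =
    ⊥-elim (not-only-first maximal (neighbourhood ≤-refl agree λ p → ≡ᵇ-⇔ p 0))
  class-allowed (single .1 , inj₂ (inj₁ refl) , agree) =
    inj₂ (inj₁ (inj₁ (neighbourhood ≤-refl agree λ p → ≡ᵇ-⇔ p 1)))
  class-allowed (single .(6 + m) , inj₂ (inj₂ (inj₁ refl)) , agree) =
    inj₂ (inj₁ (inj₂ (neighbourhood ≤-refl agree λ p → ≡ᵇ-⇔ p (6 + m))))
  class-allowed (single .(7 + m) , inj₂ (inj₂ (inj₂ refl)) , agree) =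
    ⊥-elim (not-only-last maximal (neighbourhood ≤-refl agree λ p →
      ⇔-trans (≡ᵇ-⇔ p (7 + m)) (mk⇔ (cong suc) suc-injective)))
  class-allowed (pair a , 2+a≤L , agree) =
    inj₂ (inj₂ (inj₁ (a , subst (_< 8 + m) (+-comm 2 a) (s≤s 2+a≤L) , neighbourhood ≤-refl agree (pair-⇔ a))))
  class-allowed (alternate 0 , _ , agree) =
    inj₂ (inj₂ (inj₂ (inj₁ (neighbourhood ≤-refl agree λ p → ≡ᵇ-⇔ (p % 2) 0))))
  class-allowed (alternate 1 , _ , agree) =
    inj₂ (inj₂ (inj₂ (inj₂ (inj₁ (neighbourhood ≤-refl agree λ p → ≡ᵇ-⇔ (p % 2) 1)))))
  class-allowed (alternate (suc (suc _)) , s≤s (s≤s ()) , _)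
  class-allowed (ends .(7 + m) , refl , agree) =
    inj₂ (inj₂ (inj₂ (inj₂ (inj₂ (neighbourhood ≤-refl agree (ends-⇔ (7 + m)))))))

lemmal : (G : Graph) → TriangleFree G → ¬ HasInducedT123 G →
    (k : ℕ) → 8 ≤ k → (P : Fin k → V G) → IsMaximalInducedPath G P →
    (v : V G) → (∀ i → v ≢ P i) →
      NbrOnPathIs G P v (λ _ → ⊥)
      ⊎ (NbrOnPathIs G P v (λ j → j ≡ 1) ⊎ NbrOnPathIs G P v (λ j → j ≡ k ∸ 2))
      ⊎ (∃ λ a → a + 2 < k × NbrOnPathIs G P v (λ j → j ≡ a ⊎ j ≡ a + 2))
      ⊎ NbrOnPathIs G P v (λ j → j % 2 ≡ 0)
      ⊎ NbrOnPathIs G P v (λ j → j % 2 ≡ 1)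
      ⊎ NbrOnPathIs G P v (λ j → j ≡ 0 ⊎ j ≡ k ∸ 1)
lemmal G triangle-free no-t123 _ (s≤s (s≤s (s≤s (s≤s (s≤s (s≤s (s≤s (s≤s (z≤n {m}))))))))) P maximal v v∉P =
  class-allowed G m P maximal v v∉P (classify m ≤-refl)
  where
    open OnPath G P (proj₁ maximal) v v∉P
    open NeighbourPattern (8 + m) nbr
    open Classification (no-consecutive triangle-free) (t123-free no-t123)
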